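{- Let $n\ge 1$ and let $u\in U_n$. Let $z(u)$ be the number of zero entries of $u$. Then the number of tridiagonal matrices $A\in M_n(\mathbb{F}_2)$ with all subdiagonal and superdiagonal entries equal to $1$ (diagonal arbitrary) satisfying $Au=0$ is $2^{z(u)}$.
   Context: $U_n$ denotes the set of vectors in $\mathbb{F}_2^n$ whose first and last entries are both $1$ and which have no two consecutive entries both equal to $0$. -}

module Defs where

open import Data.Bool using (Bool; true; false; _∧_; _∨_; _xor_; not; if_then_else_)
open import Data.Nat using (ℕ; zero; suc; _+_; _≡ᵇ_)
open import Data.Fin using (Fin; toℕ; inject₁)
open import Data.Fin.Base using () renaming (zero to fzero; suc to fsuc)
open import Data.List using (List; []; _∷_; concatMap; filter; length; map)
open import Data.Bool.ListAction using (and)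
open import Data.List.Base using (allFin)
open import Data.Vec using (Vec; []; _∷_; lookup; head; last; zipWith; foldr)
open import Relation.Binary.PropositionalEquality using (_≡_)
open import Data.Bool.Properties using (_≟_)

-- F₂ is modelled by Bool: addition = _xor_, multiplication = _∧_, 0 = false, 1 = true.

-- U_n (for n = suc m ≥ 1): first and last entries are 1, no two consecutive entries are 0.
record InU {m : ℕ} (u : Vec Bool (suc m)) : Set where
  field
    firstOne : head u ≡ true
    lastOne  : last u ≡ true
    noTwoZeros : (i : Fin m) → (lookup u (inject₁ i) ∨ lookup u (fsuc i)) ≡ true

numZeros : {n : ℕ} → Vec Bool n → ℕ
numZeros []            = 0
numZeros (true  ∷ bs)  = numZeros bs
numZeros (false ∷ bs)  = suc (numZeros bs)

Matrix : ℕ → Set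
Matrix n = Vec (Vec Bool n) n

entry : {n : ℕ} → Matrix n → Fin n → Fin n → Bool
entry A i j = lookup (lookup A i) j

dotF2 : {n : ℕ} → Vec Bool n → Vec Bool n → Bool
dotF2 r u = foldr (λ _ → Bool) _xor_ false (zipWith _∧_ r u)

mulRows : {k n : ℕ} → Vec (Vec Bool n) k → Vec Bool n → Vec Bool k
mulRows [] u = []
mulRows (r ∷ A) u = dotF2 r u ∷ mulRows A u

mulVec : {n : ℕ} → Matrix n → Vec Bool n → Vec Bool n
mulVec A u = mulRows A u

isZeroVec : {n : ℕ} → Vec Bool n → Bool
isZeroVec []       = true
isZeroVec (b ∷ bs) = not b ∧ isZeroVec bs

entryOk : {n : ℕ} → Fin n → Fin n → Bool → Bool
entryOk i j b =
  if toℕ i ≡ᵇ toℕ j then true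
  else if (suc (toℕ i) ≡ᵇ toℕ j) ∨ (suc (toℕ j) ≡ᵇ toℕ i) then b
  else not b

isTridiagOnes : {n : ℕ} → Matrix n → Bool
isTridiagOnes {n} A =
  and (concatMap (λ i → map (λ j → entryOk i j (entry A i j)) (allFin n)) (allFin n))

allVecs : {A : Set} → List A → (n : ℕ) → List (Vec A n)
allVecs xs zero    = [] ∷ []
allVecs xs (suc n) = concatMap (λ x → map (x ∷_) (allVecs xs n)) xs

-- all n × n matrices over F₂ (each exactly once)
allMatrices : (n : ℕ) → List (Matrix n)
allMatrices n = allVecs (allVecs (false ∷ true ∷ []) n) n

countSolutions : {n : ℕ} → Vec Bool n → ℕ
countSolutions {n} u =
  length (filter (λ A → (isTridiagOnes A ∧ isZeroVec (mulVec A u)) ≟ true) (allMatrices n))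

-- The conditions on the rows of A are independent, so the number of admissible A is the product
-- over i of the number of admissible rows i.  Row i is e_{i-1} + d e_i + e_{i+1} with d free, and
-- it kills u iff u_{i-1} + d u_i + u_{i+1} = 0.  If u_i = 1 exactly one d works; if u_i = 0 the
-- conditions defining U_n force u_{i-1} = u_{i+1} = 1, so both values of d work.
module Submission where

open import Defs
open import Data.Nat using (ℕ; zero; suc; _+_; _*_; _^_; _≡ᵇ_; _<_; s≤s; z≤n)
open import Data.Nat.Properties using (+-identityʳ; +-suc; m≤n⇒m<n∨m≡n)
open import Data.Bool using (Bool; true; false; _∧_; _∨_; _xor_; not; if_then_else_)
open import Data.Bool.Properties using (_≟_; ∧-assoc; ∧-commutativeMonoid; xor-assoc; xor-identityʳ)
open import Data.Bool.ListAction using (and)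
open import Data.List using (List; []; _∷_; _++_; filter; length; concat; concatMap; map; allFin)
open import Data.List.Properties using (map-cong; map-tabulate)
open import Data.Vec using (Vec; []; _∷_; lookup; head; last)
open import Data.Fin using (Fin; toℕ; inject₁; fromℕ<)
open import Data.Fin.Properties using (toℕ-inject₁; toℕ-fromℕ<)
open import Data.Sum using (inj₁; inj₂)
open import Algebra.Bundles using (CommutativeMonoid)
open import Algebra.Properties.CommutativeSemigroup
  (CommutativeMonoid.commutativeSemigroup ∧-commutativeMonoid) using (interchange)
open import Relation.Binary.PropositionalEquality
  using (_≡_; refl; sym; trans; cong; cong₂; subst; subst₂; module ≡-Reasoning)
open import Function using (_∘_; id)

open ≡-Reasoning

count : {A : Set} → (A → Bool) → List A → ℕ
count p []       = 0
count p (x ∷ xs) = if p x then suc (count p xs) else count p xs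

length-filter≡count : {A : Set} (p : A → Bool) (xs : List A) →
  length (filter (λ x → p x ≟ true) xs) ≡ count p xs
length-filter≡count p [] = refl
length-filter≡count p (x ∷ xs) with p x
... | true  = cong suc (length-filter≡count p xs)
... | false = length-filter≡count p xs

count-++ : {A : Set} (p : A → Bool) (xs ys : List A) → count p (xs ++ ys) ≡ count p xs + count p ys
count-++ p [] ys = refl
count-++ p (x ∷ xs) ys with p x
... | true  = cong suc (count-++ p xs ys)
... | false = count-++ p xs ys

count-map : {A B : Set} (p : B → Bool) (f : A → B) (xs : List A) → count p (map f xs) ≡ count (p ∘ f) xs
count-map p f [] = refl
count-map p f (x ∷ xs) with p (f x)
... | true  = cong suc (count-map p f xs)
... | false = count-map p f xs

count-cong : {A : Set} {p q : A → Bool} → (∀ x → p x ≡ q x) → (xs : List A) → count p xs ≡ count q xs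
count-cong p≗q [] = refl
count-cong {q = q} p≗q (x ∷ xs) rewrite p≗q x =
  cong (λ k → if q x then suc k else k) (count-cong p≗q xs)

count-guarded : {A : Set} (b : Bool) (p : A → Bool) (xs : List A) →
  count (λ x → b ∧ p x) xs ≡ (if b then count p xs else 0)
count-guarded true  p xs = refl
count-guarded false p [] = refl
count-guarded false p (x ∷ xs) = count-guarded false p xs

-- Counting vectors whose entries satisfy position-dependent conditions

allAt : {B : Set} {k : ℕ} → (ℕ → B → Bool) → ℕ → Vec B k → Bool
allAt g i []       = true
allAt g i (x ∷ xs) = g i x ∧ allAt g (suc i) xs

prodFrom : (ℕ → ℕ) → ℕ → ℕ → ℕ
prodFrom f i zero    = 1
prodFrom f i (suc k) = f i * prodFrom f (suc i) k

prodFrom-cong : {f g : ℕ → ℕ} (i k : ℕ) → (∀ j → j < k → f (i + j) ≡ g (i + j)) →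
  prodFrom f i k ≡ prodFrom g i k
prodFrom-cong i zero f≗g = refl
prodFrom-cong {f} {g} i (suc k) f≗g =
  cong₂ _*_ (subst (λ t → f t ≡ g t) (+-identityʳ i) (f≗g 0 (s≤s z≤n)))
    (prodFrom-cong (suc i) k (λ j j<k → subst (λ t → f t ≡ g t) (+-suc i j) (f≗g (suc j) (s≤s j<k))))

count-allAt-cartesian : {B : Set} {k : ℕ} (g : ℕ → B → Bool) (i : ℕ) (V : List (Vec B k)) (ys : List B) →
  count (allAt g i) (concatMap (λ y → map (y ∷_) V) ys) ≡ count (g i) ys * count (allAt g (suc i)) V
count-allAt-cartesian g i V [] = refl
count-allAt-cartesian g i V (y ∷ ys)
  rewrite count-++ (allAt g i) (map (y ∷_) V) (concatMap (λ y → map (y ∷_) V) ys)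
        | count-map (allAt g i) (y ∷_) V
        | count-guarded (g i y) (allAt g (suc i)) V
        | count-allAt-cartesian g i V ys
  with g i y
... | true  = refl
... | false = refl

count-allAt-allVecs : {B : Set} (g : ℕ → B → Bool) (xs : List B) (k i : ℕ) →
  count (allAt g i) (allVecs xs k) ≡ prodFrom (λ j → count (g j) xs) i k
count-allAt-allVecs g xs zero i = refl
count-allAt-allVecs g xs (suc k) i = begin
  count (allAt g i) (allVecs xs (suc k))
    ≡⟨ count-allAt-cartesian g i (allVecs xs k) xs ⟩
  count (g i) xs * count (allAt g (suc i)) (allVecs xs k)
    ≡⟨ cong (count (g i) xs *_) (count-allAt-allVecs g xs k (suc i)) ⟩
  prodFrom (λ j → count (g j) xs) i (suc k) ∎

-- The solution condition is a conjunction of conditions on the single rows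

entryOkℕ : ℕ → ℕ → Bool → Bool
entryOkℕ a b x =
  if a ≡ᵇ b then true
  else if (suc a ≡ᵇ b) ∨ (suc b ≡ᵇ a) then x
  else not x

rowShapeOk : {L : ℕ} → ℕ → ℕ → Vec Bool L → Bool
rowShapeOk a c []       = true
rowShapeOk a c (x ∷ xs) = entryOkℕ a c x ∧ rowShapeOk a (suc c) xs

-- isTridiagOnes A unfolds to rowsShapeOk 0 A.
rowsShapeOk : {n k : ℕ} → ℕ → Vec (Vec Bool n) k → Bool
rowsShapeOk {n} {k} a rs =
  and (concatMap (λ i → map (λ j → entryOkℕ (a + toℕ i) (toℕ j) (lookup (lookup rs i) j)) (allFin n)) (allFin k))

and-++ : (xs ys : List Bool) → and (xs ++ ys) ≡ and xs ∧ and ys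
and-++ [] ys = refl
and-++ (x ∷ xs) ys = trans (cong (x ∧_) (and-++ xs ys)) (sym (∧-assoc x (and xs) (and ys)))

map-allFin-suc : {A : Set} {n : ℕ} (f : Fin (suc n) → A) →
  map f (allFin (suc n)) ≡ f Fin.zero ∷ map (f ∘ Fin.suc) (allFin n)
map-allFin-suc f = trans (map-tabulate id f) (cong (f Fin.zero ∷_) (sym (map-tabulate id (f ∘ Fin.suc))))

and-map-entryOk≡rowShapeOk : {L : ℕ} (a c : ℕ) (r : Vec Bool L) →
  and (map (λ j → entryOkℕ a (c + toℕ j) (lookup r j)) (allFin L)) ≡ rowShapeOk a c r
and-map-entryOk≡rowShapeOk a c [] = refl
and-map-entryOk≡rowShapeOk {suc L} a c (x ∷ xs) =
  trans (cong and (map-allFin-suc (λ j → entryOkℕ a (c + toℕ j) (lookup (x ∷ xs) j))))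
    (cong₂ _∧_ (cong (λ t → entryOkℕ a t x) (+-identityʳ c))
      (trans (cong and (map-cong (λ j → cong (λ t → entryOkℕ a t (lookup xs j)) (+-suc c (toℕ j))) (allFin L)))
        (and-map-entryOk≡rowShapeOk a (suc c) xs)))

rowsShapeOk-∷ : {n k : ℕ} (a : ℕ) (r : Vec Bool n) (rs : Vec (Vec Bool n) k) →
  rowsShapeOk a (r ∷ rs) ≡ rowShapeOk a 0 r ∧ rowsShapeOk (suc a) rs
rowsShapeOk-∷ {n} {k} a r rs = begin
  and (concat (map row (allFin (suc k))))
    ≡⟨ cong (and ∘ concat) (map-allFin-suc row) ⟩
  and (row Fin.zero ++ concat (map (row ∘ Fin.suc) (allFin k)))
    ≡⟨ and-++ (row Fin.zero) _ ⟩
  and (row Fin.zero) ∧ and (concat (map (row ∘ Fin.suc) (allFin k)))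
    ≡⟨ cong₂ _∧_ firstRow laterRows ⟩
  rowShapeOk a 0 r ∧ rowsShapeOk (suc a) rs ∎
  where
  row : Fin (suc k) → List Bool
  row i = map (λ j → entryOkℕ (a + toℕ i) (toℕ j) (lookup (lookup (r ∷ rs) i) j)) (allFin n)

  firstRow : and (row Fin.zero) ≡ rowShapeOk a 0 r
  firstRow = trans (and-map-entryOk≡rowShapeOk (a + 0) 0 r) (cong (λ t → rowShapeOk t 0 r) (+-identityʳ a))

  laterRows : and (concat (map (row ∘ Fin.suc) (allFin k))) ≡ rowsShapeOk (suc a) rs
  laterRows = cong (and ∘ concat) (map-cong (λ i → map-cong (λ j →
    cong (λ t → entryOkℕ t (toℕ j) (lookup (lookup rs i) j)) (+-suc a (toℕ i))) (allFin n)) (allFin k))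

rowSolves : {n : ℕ} → Vec Bool n → ℕ → Vec Bool n → Bool
rowSolves u a r = rowShapeOk a 0 r ∧ not (dotF2 r u)

solves≡allAt-rowSolves : {n k : ℕ} (u : Vec Bool n) (a : ℕ) (rs : Vec (Vec Bool n) k) →
  rowsShapeOk a rs ∧ isZeroVec (mulRows rs u) ≡ allAt (rowSolves u) a rs
solves≡allAt-rowSolves u a [] = refl
solves≡allAt-rowSolves u a (r ∷ rs) = begin
  rowsShapeOk a (r ∷ rs) ∧ (not (dotF2 r u) ∧ isZeroVec (mulRows rs u))
    ≡⟨ cong (_∧ _) (rowsShapeOk-∷ a r rs) ⟩
  (rowShapeOk a 0 r ∧ rowsShapeOk (suc a) rs) ∧ (not (dotF2 r u) ∧ isZeroVec (mulRows rs u))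
    ≡⟨ interchange (rowShapeOk a 0 r) _ _ _ ⟩
  rowSolves u a r ∧ (rowsShapeOk (suc a) rs ∧ isZeroVec (mulRows rs u))
    ≡⟨ cong (rowSolves u a r ∧_) (solves≡allAt-rowSolves u (suc a) rs) ⟩
  allAt (rowSolves u) a (r ∷ rs) ∎

bools : List Bool
bools = false ∷ true ∷ []

countSolutions≡prodFrom : {n : ℕ} (u : Vec Bool n) →
  countSolutions u ≡ prodFrom (λ a → count (rowSolves u a) (allVecs bools n)) 0 n
countSolutions≡prodFrom {n} u = begin
  countSolutions u
    ≡⟨ length-filter≡count _ (allMatrices n) ⟩
  count (λ A → isTridiagOnes A ∧ isZeroVec (mulVec A u)) (allMatrices n)
    ≡⟨ count-cong (solves≡allAt-rowSolves u 0) (allMatrices n) ⟩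
  count (allAt (rowSolves u) 0) (allMatrices n)
    ≡⟨ count-allAt-allVecs (rowSolves u) _ n 0 ⟩
  prodFrom (λ a → count (rowSolves u a) (allVecs bools n)) 0 n ∎

-- Admissible pieces r of row a on the columns c, c+1, … such that s + r·us = 0.
rowSolutionsFrom : {L : ℕ} → ℕ → ℕ → Vec Bool L → Bool → ℕ
rowSolutionsFrom {L} a c us s = count (λ r → rowShapeOk a c r ∧ not (s xor dotF2 r us)) (allVecs bools L)

indicatorFalse : Bool → ℕ
indicatorFalse true  = 0
indicatorFalse false = 1

rowSolutionsFrom-[] : (a c : ℕ) (s : Bool) → rowSolutionsFrom a c [] s ≡ indicatorFalse s
rowSolutionsFrom-[] a c true  = refl
rowSolutionsFrom-[] a c false = refl

rowSolutionsFrom-∷ : {L : ℕ} (a c : ℕ) (x : Bool) (us : Vec Bool L) (s : Bool) →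
  rowSolutionsFrom a c (x ∷ us) s ≡
    (if entryOkℕ a c false then rowSolutionsFrom a (suc c) us s else 0) +
    (if entryOkℕ a c true then rowSolutionsFrom a (suc c) us (s xor x) else 0)
rowSolutionsFrom-∷ {L} a c x us s = begin
  count p (map (false ∷_) V ++ map (true ∷_) V ++ [])
    ≡⟨ count-++ p (map (false ∷_) V) _ ⟩
  count p (map (false ∷_) V) + count p (map (true ∷_) V ++ [])
    ≡⟨ cong₂ _+_ (count-map p (false ∷_) V)
                 (trans (count-++ p (map (true ∷_) V) []) (trans (+-identityʳ _) (count-map p (true ∷_) V))) ⟩
  count (p ∘ (false ∷_)) V + count (p ∘ (true ∷_)) V
    ≡⟨ cong₂ _+_ (trans (count-cong firstZero V) (count-guarded (entryOkℕ a c false) _ V))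
                 (trans (count-cong firstOne V) (count-guarded (entryOkℕ a c true) _ V)) ⟩
  (if entryOkℕ a c false then rowSolutionsFrom a (suc c) us s else 0) +
  (if entryOkℕ a c true then rowSolutionsFrom a (suc c) us (s xor x) else 0) ∎
  where
  V = allVecs bools L
  p = λ r → rowShapeOk a c r ∧ not (s xor dotF2 r (x ∷ us))

  firstZero : (rs : Vec Bool L) →
    p (false ∷ rs) ≡ entryOkℕ a c false ∧ (rowShapeOk a (suc c) rs ∧ not (s xor dotF2 rs us))
  firstZero rs = ∧-assoc (entryOkℕ a c false) (rowShapeOk a (suc c) rs) _

  firstOne : (rs : Vec Bool L) →
    p (true ∷ rs) ≡ entryOkℕ a c true ∧ (rowShapeOk a (suc c) rs ∧ not ((s xor x) xor dotF2 rs us))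
  firstOne rs = trans (∧-assoc (entryOkℕ a c true) (rowShapeOk a (suc c) rs) _)
    (cong (λ t → entryOkℕ a c true ∧ (rowShapeOk a (suc c) rs ∧ not t)) (sym (xor-assoc s x (dotF2 rs us))))

rowSolutionsFrom-shift : {L : ℕ} (a c : ℕ) (us : Vec Bool L) (s : Bool) →
  rowSolutionsFrom (suc a) (suc c) us s ≡ rowSolutionsFrom a c us s
rowSolutionsFrom-shift {L} a c us s =
  count-cong (λ r → cong (_∧ not (s xor dotF2 r us)) (rowShapeOk-shift c r)) (allVecs bools L)
  where
  rowShapeOk-shift : {K : ℕ} (c : ℕ) (r : Vec Bool K) → rowShapeOk (suc a) (suc c) r ≡ rowShapeOk a c r
  rowShapeOk-shift c []       = refl
  rowShapeOk-shift c (x ∷ xs) = cong (entryOkℕ a c x ∧_) (rowShapeOk-shift (suc c) xs)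

rowSolutionsFrom-beyondBand : {L : ℕ} (c : ℕ) (us : Vec Bool L) (s : Bool) →
  rowSolutionsFrom 0 (suc (suc c)) us s ≡ indicatorFalse s
rowSolutionsFrom-beyondBand c [] s = rowSolutionsFrom-[] 0 (suc (suc c)) s
rowSolutionsFrom-beyondBand c (x ∷ us) s =
  trans (rowSolutionsFrom-∷ 0 (suc (suc c)) x us s)
    (trans (+-identityʳ _) (rowSolutionsFrom-beyondBand (suc c) us s))

-- u extended by zeros on both sides: entryAt u i is u_i, entryBefore u i is u_{i-1}.
entryAt : {L : ℕ} → Vec Bool L → ℕ → Bool
entryAt []       _       = false
entryAt (x ∷ xs) zero    = x
entryAt (x ∷ xs) (suc i) = entryAt xs i

entryBefore : {L : ℕ} → Vec Bool L → ℕ → Bool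
entryBefore u zero    = false
entryBefore u (suc i) = entryAt u i

rowSolutionsFrom-superdiagonal : {L : ℕ} (us : Vec Bool L) (s : Bool) →
  rowSolutionsFrom 0 1 us s ≡ indicatorFalse (s xor entryAt us 0)
rowSolutionsFrom-superdiagonal [] s =
  trans (rowSolutionsFrom-[] 0 1 s) (cong indicatorFalse (sym (xor-identityʳ s)))
rowSolutionsFrom-superdiagonal (y ∷ us) s =
  trans (rowSolutionsFrom-∷ 0 1 y us s) (rowSolutionsFrom-beyondBand 0 us (s xor y))

-- The number of d with a + d x + y = 0 in F₂.
diagonalChoices : Bool → Bool → Bool → ℕ
diagonalChoices a x y = indicatorFalse (a xor y) + indicatorFalse ((a xor x) xor y)

rowSolutionsFrom≡diagonalChoices : {L : ℕ} (i : ℕ) (u : Vec Bool L) (s : Bool) → i < L →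
  rowSolutionsFrom i 0 u s ≡ diagonalChoices (s xor entryBefore u i) (entryAt u i) (entryAt u (suc i))
rowSolutionsFrom≡diagonalChoices zero (x ∷ us) s _ rewrite xor-identityʳ s =
  trans (rowSolutionsFrom-∷ 0 0 x us s)
    (cong₂ _+_ (rowSolutionsFrom-superdiagonal us s) (rowSolutionsFrom-superdiagonal us (s xor x)))
rowSolutionsFrom≡diagonalChoices (suc zero) (x ∷ us) s (s≤s 0<L) = begin
  rowSolutionsFrom 1 0 (x ∷ us) s
    ≡⟨ rowSolutionsFrom-∷ 1 0 x us s ⟩
  rowSolutionsFrom 1 1 us (s xor x)
    ≡⟨ rowSolutionsFrom-shift 0 0 us (s xor x) ⟩
  rowSolutionsFrom 0 0 us (s xor x)
    ≡⟨ rowSolutionsFrom≡diagonalChoices zero us (s xor x) 0<L ⟩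
  diagonalChoices ((s xor x) xor false) (entryAt us 0) (entryAt us 1)
    ≡⟨ cong (λ t → diagonalChoices t (entryAt us 0) (entryAt us 1)) (xor-identityʳ (s xor x)) ⟩
  diagonalChoices (s xor x) (entryAt us 0) (entryAt us 1) ∎
rowSolutionsFrom≡diagonalChoices (suc (suc i)) (x ∷ us) s (s≤s i<L) = begin
  rowSolutionsFrom (suc (suc i)) 0 (x ∷ us) s
    ≡⟨ trans (rowSolutionsFrom-∷ (suc (suc i)) 0 x us s) (+-identityʳ _) ⟩
  rowSolutionsFrom (suc (suc i)) 1 us s
    ≡⟨ rowSolutionsFrom-shift (suc i) 0 us s ⟩
  rowSolutionsFrom (suc i) 0 us s
    ≡⟨ rowSolutionsFrom≡diagonalChoices (suc i) us s i<L ⟩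
  diagonalChoices (s xor entryAt us i) (entryAt us (suc i)) (entryAt us (suc (suc i))) ∎

entryAt-lookup : {L : ℕ} (u : Vec Bool L) (i : Fin L) → lookup u i ≡ entryAt u (toℕ i)
entryAt-lookup (x ∷ xs) Fin.zero    = refl
entryAt-lookup (x ∷ xs) (Fin.suc i) = entryAt-lookup xs i

entryAt-head : {m : ℕ} (u : Vec Bool (suc m)) → head u ≡ entryAt u 0
entryAt-head (x ∷ xs) = refl

entryAt-last : {m : ℕ} (u : Vec Bool (suc m)) → last u ≡ entryAt u m
entryAt-last {zero}  (x ∷ [])     = refl
entryAt-last {suc m} (x ∷ y ∷ ys) = entryAt-last (y ∷ ys)

module _ {m : ℕ} {u : Vec Bool (suc m)} (u∈U : InU u) where

  noTwoZeros : (j : ℕ) → j < m → (entryAt u j ∨ entryAt u (suc j)) ≡ true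
  noTwoZeros j j<m =
    subst (λ t → (entryAt u t ∨ entryAt u (suc t)) ≡ true) (toℕ-fromℕ< j<m)
      (subst₂ (λ a b → (a ∨ b) ≡ true)
        (trans (entryAt-lookup u (inject₁ i)) (cong (entryAt u) (toℕ-inject₁ i)))
        (entryAt-lookup u (Fin.suc i))
        (InU.noTwoZeros u∈U i))
    where i = fromℕ< j<m

  zero⇒before≡true : (j : ℕ) → j < suc m → entryAt u j ≡ false → entryBefore u j ≡ true
  zero⇒before≡true zero _ uⱼ≡false with () ← trans (sym (trans (sym (entryAt-head u)) (InU.firstOne u∈U))) uⱼ≡false
  zero⇒before≡true (suc j) (s≤s j<m) uⱼ≡false with entryAt u j | noTwoZeros j j<m
  ... | true | _ = refl
  ... | false | u₍ⱼ₊₁₎≡true with () ← trans (sym u₍ⱼ₊₁₎≡true) uⱼ≡false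

  zero⇒after≡true : (j : ℕ) → j < suc m → entryAt u j ≡ false → entryAt u (suc j) ≡ true
  zero⇒after≡true j (s≤s j≤m) uⱼ≡false with m≤n⇒m<n∨m≡n j≤m
  ... | inj₂ refl with () ← trans (sym (trans (sym (entryAt-last u)) (InU.lastOne u∈U))) uⱼ≡false
  ... | inj₁ j<m with entryAt u j | noTwoZeros j j<m
  ... | false | u₍ⱼ₊₁₎≡true = u₍ⱼ₊₁₎≡true
  ... | true  | _ with () ← uⱼ≡false

weight : Bool → ℕ
weight true  = 1
weight false = 2

diagonalChoices≡weight : {m : ℕ} {u : Vec Bool (suc m)} → InU u → (j : ℕ) → j < suc m →
  diagonalChoices (entryBefore u j) (entryAt u j) (entryAt u (suc j)) ≡ weight (entryAt u j)
diagonalChoices≡weight {u = u} u∈U j j<n with entryAt u j in uⱼ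
... | true with entryBefore u j | entryAt u (suc j)
...   | true  | true  = refl
...   | true  | false = refl
...   | false | true  = refl
...   | false | false = refl
diagonalChoices≡weight {u = u} u∈U j j<n | false
  rewrite zero⇒before≡true u∈U j j<n uⱼ | zero⇒after≡true u∈U j j<n uⱼ = refl

prodFrom-suc : (f : ℕ → ℕ) (i k : ℕ) → prodFrom f (suc i) k ≡ prodFrom (f ∘ suc) i k
prodFrom-suc f i zero    = refl
prodFrom-suc f i (suc k) = cong (f (suc i) *_) (prodFrom-suc f (suc i) k)

prodFrom-weight≡2^numZeros : {L : ℕ} (u : Vec Bool L) → prodFrom (weight ∘ entryAt u) 0 L ≡ 2 ^ numZeros u
prodFrom-weight≡2^numZeros [] = refl
prodFrom-weight≡2^numZeros {suc L} (true ∷ us) =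
  trans (+-identityʳ _) (trans (prodFrom-suc _ 0 L) (prodFrom-weight≡2^numZeros us))
prodFrom-weight≡2^numZeros {suc L} (false ∷ us) =
  cong (2 *_) (trans (prodFrom-suc _ 0 L) (prodFrom-weight≡2^numZeros us))

mainTheorem5 : (m : ℕ) (u : Vec Bool (suc m)) → InU u →
    countSolutions u ≡ 2 ^ numZeros u
mainTheorem5 m u u∈U = begin
  countSolutions u
    ≡⟨ countSolutions≡prodFrom u ⟩
  prodFrom (λ a → rowSolutionsFrom a 0 u false) 0 (suc m)
    ≡⟨ prodFrom-cong 0 (suc m) (λ j j<n →
         trans (rowSolutionsFrom≡diagonalChoices j u false j<n) (diagonalChoices≡weight u∈U j j<n)) ⟩
  prodFrom (weight ∘ entryAt u) 0 (suc m)
    ≡⟨ prodFrom-weight≡2^numZeros u ⟩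
  2 ^ numZeros u ∎
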